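{- Let $p$ be a prime, $k$ a positive integer, and $C_n$ a cycle whose edges are labeled by ideals of $\mathbb{Z}/p^k\mathbb{Z}$ that are neither zero nor the whole ring, so each label is $\langle p^{j}\rangle$ with $1\le j\le k-1$. Label the vertices $v_1,\dots,v_n$ around the cycle, with edges $\ell_i=v_iv_{i+1}$ ($1\le i\le n-1$) and $\ell_n=v_nv_1$, chosen so that the label $p^{j_n}$ on $\ell_n$ has exponent $j_n$ minimal among all edge labels; write $\ell_i$ also for the label $p^{j_i}$ on edge $\ell_i$. For $1\le i\le n-1$ let $b^{(i)}$ be the vertex-labeling with $b^{(i)}_{v_j}=0$ for $j\le i$ and $b^{(i)}_{v_j}=\ell_i$ for $j>i$, and let $\mathbf{1}$ be the all-ones vertex-labeling. Then $\{\mathbf{1},b^{(1)},\dots,b^{(n-1)}\}$ is a minimum generating set of the $\mathbb{Z}$-module of splines on $C_n$ over $\mathbb{Z}/p^k\mathbb{Z}$.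
   Context: For a finite graph $G=(V,E)$ with edge-labeling by ideals of $R=\mathbb{Z}/p^k\mathbb{Z}$, a spline is $f\in R^{|V|}$ with $f_u-f_v$ in the ideal labeling $uv$ for every edge $uv$. A minimum generating set is a generating set with the smallest possible number of elements. -}

module Defs where

open import Data.Nat as ℕ using (ℕ; zero; suc; _^_; _≤ᵇ_)
open import Data.Nat.DivMod using (_mod_)
open import Data.Fin using (Fin; toℕ; inject₁; zero; suc)
open import Data.Integer using (ℤ; +_; _-_; _*_; _+_)
open import Data.Integer.Divisibility using (_∣_)
open import Data.Product using (Σ; ∃; _×_)
open import Data.Bool using (if_then_else_)

-- The ring Z/p^k Z is represented by integers taken modulo p^k.
-- Congruence modulo p^k : equality in Z/p^k Z.
_≡[_]_ : ℤ → ℕ → ℤ → Set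
x ≡[ q ] y = (+ q) ∣ (x - y)

InIdeal : (p k j : ℕ) → ℤ → Set
InIdeal p k j x = ∃ λ (s : ℤ) → x ≡[ p ^ k ] ((+ (p ^ j)) * s)

Labeling : ℕ → Set
Labeling n = Fin n → ℤ

-- The cycle C_{m+1}: vertices 0..m, edge i joins vertex i and vertex (i+1) mod (m+1).
-- (0-indexed: vertex t is v_{t+1}, edge i is ℓ_{i+1}; edge m is ℓ_n = v_n v_1.)
cycTgt : ∀ {m} → Fin (suc m) → Fin (suc m)
cycTgt {m} i = (suc (toℕ i)) mod (suc m)

IsSpline : (p k : ℕ) {m : ℕ} (j : Fin (suc m) → ℕ) → Labeling (suc m) → Set
IsSpline p k j f = ∀ i → InIdeal p k (j i) (f i - f (cycTgt i))

sumFin : ∀ {r} → (Fin r → ℤ) → ℤ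
sumFin {zero} c = + 0
sumFin {suc r} c = c zero + sumFin (λ i → c (suc i))

linComb : ∀ {n r} → (Fin r → ℤ) → (Fin r → Labeling n) → Labeling n
linComb c g v = sumFin (λ i → c i * g i v)

Generates : (p k : ℕ) {m : ℕ} (j : Fin (suc m) → ℕ) {r : ℕ} → (Fin r → Labeling (suc m)) → Set
Generates p k j {r} g =
  (∀ i → IsSpline p k j (g i)) ×
  (∀ f → IsSpline p k j f →
     ∃ λ (c : Fin r → ℤ) → ∀ v → f v ≡[ p ^ k ] linComb c g v)

MinimumGenerating : (p k : ℕ) {m : ℕ} (j : Fin (suc m) → ℕ) {r : ℕ} → (Fin r → Labeling (suc m)) → Set
MinimumGenerating p k {m} j {r} g =
  Generates p k j g ×
  (∀ (r' : ℕ) (g' : Fin r' → Labeling (suc m)) → Generates p k j g' → r ℕ.≤ r')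

-- b^(i+1) (0-indexed i : Fin m): 0 on v_1..v_{i+1}, the label p^(j_{i+1}) of edge ℓ_{i+1} afterwards.
bVec : (p : ℕ) {m : ℕ} (j : Fin (suc m) → ℕ) → Fin m → Labeling (suc m)
bVec p j i v = if toℕ v ≤ᵇ toℕ i then + 0 else + (p ^ j (inject₁ i))

splineGens : (p : ℕ) {m : ℕ} (j : Fin (suc m) → ℕ) → Fin (suc m) → Labeling (suc m)
splineGens p j zero v = + 1
splineGens p j (suc i) v = bVec p j i v

module Submission where

-- Labelings are integer functions read modulo q = p^k; ℓᵢ = p^(jᵢ) labels edge vᵢvᵢ₊₁.
--  * Generation.  b⁽ⁱ⁾ jumps by ℓᵢ across edge i and across the closing edge, where
--    ℓᵢ ∈ ⟨ℓₙ⟩ by minimality of jₙ.  A spline f with f(vᵢ) − f(vᵢ₊₁) ≡ ℓᵢσᵢ agrees with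
--    f(v₁)·1 − Σ σᵢb⁽ⁱ⁾ at v₁ and in every increment along v₁ … vₙ, hence everywhere.
--  * Independence.  If Σ dₛgₛ ≡ p·H (mod q) with H a spline, then p ∣ dₛ for all s:
--    at v₁ this is d₀ ≡ pH(v₁); across edge i it gives ℓᵢ(dᵢ₊₁ + pσ) ≡ 0 with ℓᵢp ∣ q.
--  * Counting.  Expressing the n generators through a generating family of size r
--    gives n vectors of ℤʳ independent modulo p, and elimination over 𝔽ₚ gives n ≤ r.

open import Defs
open import Data.Nat as ℕ using (ℕ; zero; suc; _^_; _≤_; _<_; _∸_; z≤n; s≤s)
import Data.Nat.Properties as ℕP
import Data.Nat.Divisibility as ℕD
open import Data.Nat.Primality using (Prime; euclidsLemma; prime⇒nonTrivial; prime⇒nonZero)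
open import Data.Nat.DivMod using (_%_; n%n≡0; m<n⇒m%n≡m)
open import Data.Fin using (Fin; zero; suc; toℕ; inject₁; fromℕ; punchIn; _≟_)
import Data.Fin.Properties as FinP
open import Data.Fin.Induction using (<-weakInduction)
open import Data.Vec.Functional using (insertAt)
open import Data.Vec.Functional.Properties using (insertAt-lookup; insertAt-punchIn)
open import Data.Integer using (ℤ; +_; _+_; _-_; _*_; -_; ∣_∣)
import Data.Integer.Properties as ℤP
open import Data.Integer.Divisibility.Signed
  using (_∣_; divides; ∣ᵤ⇒∣; ∣⇒∣ᵤ; ∣-refl; ∣-trans; ∣m∣n⇒∣m+n; ∣m⇒∣-m; ∣m∣n⇒∣m-n;
         ∣m+n∣n⇒∣m; ∣n⇒∣m*n; ∣m⇒∣m*n; *-cancelˡ-∣)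
open import Data.Integer.Tactic.RingSolver using (solve-∀)
open import Algebra.Properties.Ring ℤP.+-*-ring using (x[y-z]≈xy-xz)
open import Algebra.Properties.Semiring.Sum ℤP.+-*-semiring
  using (sum; sum-remove; ∑-comm; *-distribˡ-sum; *-distribʳ-sum; sum-replicate-zero)
open import Data.Bool using (true; false; T; if_then_else_)
open import Data.Product using (∃; _,_; proj₁; proj₂)
open import Data.Sum using (_⊎_; inj₁; inj₂)
open import Data.Empty using (⊥-elim)
open import Function using (_∘_)
open import Relation.Nullary using (¬_; Dec; yes; no)
open import Relation.Nullary.Decidable using (map′)
open import Relation.Binary.Definitions using (tri<; tri≈; tri>)
open import Relation.Binary.PropositionalEquality
open ≡-Reasoning

sumFin≡sum : ∀ {n} (f : Fin n → ℤ) → sumFin f ≡ sum f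
sumFin≡sum {zero} f = refl
sumFin≡sum {suc n} f = cong (_+_ (f zero)) (sumFin≡sum (λ i → f (suc i)))

sumFin-cong : ∀ {n} {f g : Fin n → ℤ} → (∀ i → f i ≡ g i) → sumFin f ≡ sumFin g
sumFin-cong {zero} eq = refl
sumFin-cong {suc n} eq = cong₂ _+_ (eq zero) (sumFin-cong (λ i → eq (suc i)))

sumFin-*ˡ : ∀ {n} a (f : Fin n → ℤ) → sumFin (λ i → a * f i) ≡ a * sumFin f
sumFin-*ˡ a f rewrite sumFin≡sum (λ i → a * f i) | sumFin≡sum f = sym (*-distribˡ-sum a f)

sumFin-*ʳ : ∀ {n} a (f : Fin n → ℤ) → sumFin (λ i → f i * a) ≡ sumFin f * a
sumFin-*ʳ a f rewrite sumFin≡sum (λ i → f i * a) | sumFin≡sum f = sym (*-distribʳ-sum a f)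

sumFin-comm : ∀ {m n} (f : Fin m → Fin n → ℤ) →
  sumFin (λ s → sumFin (f s)) ≡ sumFin (λ t → sumFin (λ s → f s t))
sumFin-comm f = begin
  sumFin (λ s → sumFin (f s))            ≡⟨ sumFin-cong (λ s → sumFin≡sum (f s)) ⟩
  sumFin (λ s → sum (f s))               ≡⟨ sumFin≡sum (λ s → sum (f s)) ⟩
  sum (λ s → sum (f s))                  ≡⟨ ∑-comm f ⟩
  sum (λ t → sum (λ s → f s t))          ≡⟨ sym (sumFin≡sum (λ t → sum (λ s → f s t))) ⟩
  sumFin (λ t → sum (λ s → f s t))       ≡⟨ sumFin-cong (λ t → sym (sumFin≡sum (λ s → f s t))) ⟩
  sumFin (λ t → sumFin (λ s → f s t))    ∎

sumFin-- : ∀ {n} (f g : Fin n → ℤ) → sumFin (λ i → f i - g i) ≡ sumFin f - sumFin g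
sumFin-- {zero} f g = refl
sumFin-- {suc n} f g = begin
  (f zero - g zero) + sumFin (λ i → f (suc i) - g (suc i))
    ≡⟨ cong (_+_ (f zero - g zero)) (sumFin-- (λ i → f (suc i)) (λ i → g (suc i))) ⟩
  (f zero - g zero) + (sumFin (λ i → f (suc i)) - sumFin (λ i → g (suc i)))
    ≡⟨ interchange (f zero) (g zero) _ _ ⟩
  (f zero + sumFin (λ i → f (suc i))) - (g zero + sumFin (λ i → g (suc i))) ∎
  where
  interchange : ∀ a b c d → (a - b) + (c - d) ≡ (a + c) - (b + d)
  interchange = solve-∀

sumFin-single : ∀ {n} (f : Fin n → ℤ) (i : Fin n) → (∀ u → u ≢ i → f u ≡ + 0) → sumFin f ≡ f i
sumFin-single {suc n} f i others = begin
  sumFin f                                  ≡⟨ sumFin≡sum f ⟩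
  sum f                                     ≡⟨ sum-remove {i = i} f ⟩
  f i + sum (λ u → f (punchIn i u))         ≡⟨ cong (_+_ (f i)) rest ⟩
  f i + + 0                                 ≡⟨ ℤP.+-identityʳ (f i) ⟩
  f i                                       ∎
  where
  rest : sum (λ u → f (punchIn i u)) ≡ + 0
  rest = begin
    sum (λ u → f (punchIn i u))  ≡⟨ sym (sumFin≡sum (λ u → f (punchIn i u))) ⟩
    sumFin (λ u → f (punchIn i u)) ≡⟨ sumFin-cong (λ u → others (punchIn i u) (FinP.punchInᵢ≢i i u)) ⟩
    sumFin {n} (λ _ → + 0)       ≡⟨ sumFin≡sum {n} (λ _ → + 0) ⟩
    sum {n} (λ _ → + 0)          ≡⟨ sum-replicate-zero n ⟩
    + 0                          ∎

sumFin-insertAt : ∀ {n} (c : Fin n → ℤ) (s : Fin (suc n)) (a : ℤ) (w : Fin (suc n) → ℤ) →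
  sumFin (λ u → insertAt c s a u * w u) ≡ a * w s + sumFin (λ u → c u * w (punchIn s u))
sumFin-insertAt c s a w = begin
  sumFin (λ u → insertAt c s a u * w u)
    ≡⟨ sumFin≡sum (λ u → insertAt c s a u * w u) ⟩
  sum (λ u → insertAt c s a u * w u)
    ≡⟨ sum-remove {i = s} (λ u → insertAt c s a u * w u) ⟩
  insertAt c s a s * w s + sum (λ u → insertAt c s a (punchIn s u) * w (punchIn s u))
    ≡⟨ cong₂ _+_ (cong (_* w s) (insertAt-lookup c s a))
                 (sym (sumFin≡sum (λ u → insertAt c s a (punchIn s u) * w (punchIn s u)))) ⟩
  a * w s + sumFin (λ u → insertAt c s a (punchIn s u) * w (punchIn s u))
    ≡⟨ cong (_+_ (a * w s)) (sumFin-cong (λ u → cong (_* w (punchIn s u)) (insertAt-punchIn c s a u))) ⟩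
  a * w s + sumFin (λ u → c u * w (punchIn s u)) ∎

sumFin-dvd : ∀ {n} d (f : Fin n → ℤ) → (∀ i → d ∣ f i) → d ∣ sumFin f
sumFin-dvd {zero} d f h = divides (+ 0) refl
sumFin-dvd {suc n} d f h = ∣m∣n⇒∣m+n (h zero) (sumFin-dvd d (λ i → f (suc i)) (λ i → h (suc i)))

linComb-diff : ∀ {n r} (c : Fin r → ℤ) (g : Fin r → Labeling n) u v →
  linComb c g u - linComb c g v ≡ sumFin (λ t → c t * (g t u - g t v))
linComb-diff c g u v = begin
  linComb c g u - linComb c g v
    ≡⟨ sym (sumFin-- (λ t → c t * g t u) (λ t → c t * g t v)) ⟩
  sumFin (λ t → c t * g t u - c t * g t v)
    ≡⟨ sumFin-cong (λ t → sym (x[y-z]≈xy-xz (c t) (g t u) (g t v))) ⟩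
  sumFin (λ t → c t * (g t u - g t v)) ∎

linComb-compose : ∀ {n N r} (d : Fin N → ℤ) (C : Fin N → Fin r → ℤ) (g : Fin r → Labeling n) v →
  sumFin (λ s → d s * linComb (C s) g v) ≡ linComb (λ t → sumFin (λ s → d s * C s t)) g v
linComb-compose d C g v = begin
  sumFin (λ s → d s * sumFin (λ t → C s t * g t v))
    ≡⟨ sumFin-cong (λ s → sym (sumFin-*ˡ (d s) (λ t → C s t * g t v))) ⟩
  sumFin (λ s → sumFin (λ t → d s * (C s t * g t v)))
    ≡⟨ sumFin-cong (λ s → sumFin-cong (λ t → sym (ℤP.*-assoc (d s) (C s t) (g t v)))) ⟩
  sumFin (λ s → sumFin (λ t → d s * C s t * g t v))
    ≡⟨ sumFin-comm (λ s t → d s * C s t * g t v) ⟩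
  sumFin (λ t → sumFin (λ s → d s * C s t * g t v))
    ≡⟨ sumFin-cong (λ t → sumFin-*ʳ (g t v) (λ s → d s * C s t)) ⟩
  sumFin (λ t → sumFin (λ s → d s * C s t) * g t v) ∎

-- Congruence of integers modulo q, phrased with signed divisibility (Defs' _≡[_]_
-- uses divisibility of absolute values).  A record, so that both sides stay
-- inferable from the type.

infix 4 _≈[_]_
record _≈[_]_ (x : ℤ) (q : ℕ) (y : ℤ) : Set where
  constructor modulo
  field q∣x-y : + q ∣ x - y
open _≈[_]_ public

≈-reflexive : ∀ {q x y} → x ≡ y → x ≈[ q ] y
≈-reflexive {q} {x} refl = modulo (subst (+ q ∣_) (sym (ℤP.+-inverseʳ x)) (divides (+ 0) refl))

≈-trans : ∀ {q x y z} → x ≈[ q ] y → y ≈[ q ] z → x ≈[ q ] z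
≈-trans {q} {x} {y} {z} (modulo xy) (modulo yz) = modulo (subst (+ q ∣_) (telescope x y z) (∣m∣n⇒∣m+n xy yz))
  where
  telescope : ∀ x y z → (x - y) + (y - z) ≡ x - z
  telescope = solve-∀

≈-swapDiff : ∀ {q} a b x → a - b ≈[ q ] x → b - a ≈[ q ] - x
≈-swapDiff {q} a b x (modulo h) = modulo (subst (+ q ∣_) (negate a b x) (∣m⇒∣-m h))
  where
  negate : ∀ a b x → - ((a - b) - x) ≡ (b - a) - - x
  negate = solve-∀

≈-weightedSum : ∀ {q n} (c x y : Fin n → ℤ) → (∀ i → x i ≈[ q ] y i) →
  sumFin (λ i → c i * x i) ≈[ q ] sumFin (λ i → c i * y i)
≈-weightedSum {q} c x y xy = modulo (subst (+ q ∣_) (begin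
  sumFin (λ i → c i * (x i - y i))          ≡⟨ sumFin-cong (λ i → x[y-z]≈xy-xz (c i) (x i) (y i)) ⟩
  sumFin (λ i → c i * x i - c i * y i)      ≡⟨ sumFin-- (λ i → c i * x i) (λ i → c i * y i) ⟩
  sumFin (λ i → c i * x i) - sumFin (λ i → c i * y i) ∎)
  (sumFin-dvd (+ q) (λ i → c i * (x i - y i)) (λ i → ∣n⇒∣m*n (c i) (q∣x-y (xy i)))))

≈-byIncrements : ∀ {q m} (f g : Labeling (suc m)) → f zero ≈[ q ] g zero →
  (∀ i → f (suc i) - f (inject₁ i) ≈[ q ] g (suc i) - g (inject₁ i)) →
  ∀ v → f v ≈[ q ] g v
≈-byIncrements {q} f g start step = <-weakInduction (λ v → f v ≈[ q ] g v) start next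
  where
  next : ∀ i → f (inject₁ i) ≈[ q ] g (inject₁ i) → f (suc i) ≈[ q ] g (suc i)
  next i (modulo hyp) = modulo (subst (+ q ∣_) (regroup (f (inject₁ i)) (f (suc i)) (g (inject₁ i)) (g (suc i)))
                                  (∣m∣n⇒∣m+n hyp (q∣x-y (step i))))
    where
    regroup : ∀ a b c d → (a - c) + ((b - a) - (d - c)) ≡ b - d
    regroup = solve-∀

module IndependenceModPrime (p : ℕ) (p-prime : Prime p) where

  p∣? : ∀ x → Dec (+ p ∣ x)
  p∣? x = map′ ∣ᵤ⇒∣ ∣⇒∣ᵤ (p ℕD.∣? ∣ x ∣)

  p∤1 : ¬ (+ p ∣ + 1)
  p∤1 h with ℕD.∣1⇒≡1 (∣⇒∣ᵤ h) | prime⇒nonTrivial p-prime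
  ... | refl | ()

  cancel-unit : ∀ b {a} → ¬ (+ p ∣ a) → + p ∣ b * a → + p ∣ b
  cancel-unit b {a} p∤a h with euclidsLemma ∣ b ∣ ∣ a ∣ p-prime (subst (p ℕD.∣_) (ℤP.abs-* b a) (∣⇒∣ᵤ h))
  ... | inj₁ p∣b = ∣ᵤ⇒∣ p∣b
  ... | inj₂ p∣a = ⊥-elim (p∤a (∣ᵤ⇒∣ p∣a))

  Independent : ∀ {N r} → (Fin N → Fin r → ℤ) → Set
  Independent {N} {r} x =
    ∀ (d : Fin N → ℤ) → (∀ t → + p ∣ sumFin (λ s → d s * x s t)) → ∀ s → + p ∣ d s

  dropNullColumn : ∀ {N r} (x : Fin N → Fin (suc r) → ℤ) → (∀ s → + p ∣ x s zero) →
    Independent x → Independent (λ s t → x s (suc t))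
  dropNullColumn x null ind d rest = ind d column
    where
    column : ∀ t → + p ∣ sumFin (λ s → d s * x s t)
    column zero = sumFin-dvd (+ p) (λ s → d s * x s zero) (λ s → ∣n⇒∣m*n (d s) (null s))
    column (suc t) = rest t

  module Elimination {N r : ℕ} (x : Fin (suc N) → Fin (suc r) → ℤ) (s₀ : Fin (suc N)) where

    pivot : ℤ
    pivot = x s₀ zero

    eliminated : Fin N → Fin r → ℤ
    eliminated u t = pivot * x (punchIn s₀ u) (suc t) - x (punchIn s₀ u) zero * x s₀ (suc t)

    -- A relation d among the eliminated rows lifts to the relation D among the
    -- original rows: D(punchIn s₀ u) = d u · a and D(s₀) = −Σ d u · xᵤ(0).
    module Lift (d : Fin N → ℤ) where

      S₀ : ℤ
      S₀ = sumFin (λ u → d u * x (punchIn s₀ u) zero)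

      D : Fin (suc N) → ℤ
      D = insertAt (λ u → d u * pivot) s₀ (- S₀)

      R : Fin (suc r) → ℤ
      R t = sumFin (λ u → d u * pivot * x (punchIn s₀ u) t)

      expand : ∀ t → sumFin (λ s → D s * x s t) ≡ - S₀ * x s₀ t + R t
      expand t = sumFin-insertAt (λ u → d u * pivot) s₀ (- S₀) (λ s → x s t)

      firstColumn : sumFin (λ s → D s * x s zero) ≡ + 0
      firstColumn = begin
        sumFin (λ s → D s * x s zero)
          ≡⟨ expand zero ⟩
        - S₀ * pivot + R zero
          ≡⟨ cong (_+_ (- S₀ * pivot)) (sumFin-cong (λ u → swap (d u) pivot (x (punchIn s₀ u) zero))) ⟩
        - S₀ * pivot + sumFin (λ u → d u * x (punchIn s₀ u) zero * pivot)
          ≡⟨ cong (_+_ (- S₀ * pivot)) (sumFin-*ʳ pivot (λ u → d u * x (punchIn s₀ u) zero)) ⟩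
        - S₀ * pivot + S₀ * pivot
          ≡⟨ cancel S₀ pivot ⟩
        + 0 ∎
        where
        swap : ∀ a b c → a * b * c ≡ a * c * b
        swap = solve-∀
        cancel : ∀ S a → - S * a + S * a ≡ + 0
        cancel = solve-∀

      laterColumn : ∀ t → sumFin (λ u → d u * eliminated u t) ≡ sumFin (λ s → D s * x s (suc t))
      laterColumn t = begin
        sumFin (λ u → d u * eliminated u t)
          ≡⟨ sumFin-cong (λ u → distribute (d u) pivot (x (punchIn s₀ u) (suc t)) (x (punchIn s₀ u) zero) b) ⟩
        sumFin (λ u → d u * pivot * x (punchIn s₀ u) (suc t) - d u * x (punchIn s₀ u) zero * b)
          ≡⟨ sumFin-- (λ u → d u * pivot * x (punchIn s₀ u) (suc t)) (λ u → d u * x (punchIn s₀ u) zero * b) ⟩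
        R (suc t) - sumFin (λ u → d u * x (punchIn s₀ u) zero * b)
          ≡⟨ cong (_-_ (R (suc t))) (sumFin-*ʳ b (λ u → d u * x (punchIn s₀ u) zero)) ⟩
        R (suc t) - S₀ * b
          ≡⟨ reorder (R (suc t)) S₀ b ⟩
        - S₀ * b + R (suc t)
          ≡⟨ sym (expand (suc t)) ⟩
        sumFin (λ s → D s * x s (suc t)) ∎
        where
        b = x s₀ (suc t)
        distribute : ∀ d a y y₀ b → d * (a * y - y₀ * b) ≡ d * a * y - d * y₀ * b
        distribute = solve-∀
        reorder : ∀ A S b → A - S * b ≡ - S * b + A
        reorder = solve-∀

    eliminate : ¬ (+ p ∣ pivot) → Independent x → Independent eliminated
    eliminate p∤pivot ind d rel u = cancel-unit (d u) p∤pivot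
      (subst (+ p ∣_) (insertAt-punchIn (λ u → d u * pivot) s₀ (- S₀) u) (ind D relD (punchIn s₀ u)))
      where
      open Lift d
      relD : ∀ t → + p ∣ sumFin (λ s → D s * x s t)
      relD zero = subst (+ p ∣_) (sym firstColumn) (divides (+ 0) refl)
      relD (suc t) = subst (+ p ∣_) (laterColumn t) (rel t)

  independent⇒≤ : ∀ {N r} (x : Fin N → Fin r → ℤ) → Independent x → N ≤ r
  independent⇒≤ {zero} x ind = z≤n
  independent⇒≤ {suc N} {zero} x ind = ⊥-elim (p∤1 (ind (λ _ → + 1) (λ ()) zero))
  independent⇒≤ {suc N} {suc r} x ind with FinP.all? (λ s → p∣? (x s zero))
  ... | yes null = ℕP.m≤n⇒m≤1+n (independent⇒≤ (λ s t → x s (suc t)) (dropNullColumn x null ind))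
  ... | no ¬null with FinP.¬∀⟶∃¬ (suc N) _ (λ s → p∣? (x s zero)) ¬null
  ...   | s₀ , p∤pivot = s≤s (independent⇒≤ (Elimination.eliminated x s₀) (Elimination.eliminate x s₀ p∤pivot ind))

pow-split : ∀ p {a b} → a ≤ b → + (p ^ b) ≡ + (p ^ a) * + (p ^ (b ∸ a))
pow-split p {a} {b} a≤b = begin
  + (p ^ b)                   ≡⟨ cong (λ e → + (p ^ e)) (sym (ℕP.m+[n∸m]≡n a≤b)) ⟩
  + (p ^ (a ℕ.+ (b ∸ a)))     ≡⟨ cong (+_) (ℕP.^-distribˡ-+-* p a (b ∸ a)) ⟩
  + (p ^ a ℕ.* p ^ (b ∸ a))   ≡⟨ ℤP.pos-* (p ^ a) (p ^ (b ∸ a)) ⟩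
  + (p ^ a) * + (p ^ (b ∸ a)) ∎

pow-step-dvd : ∀ p {a b} → a < b → + (p ^ a) * + p ∣ + (p ^ b)
pow-step-dvd p {a} {b} a<b = divides (+ (p ^ (b ∸ suc a))) (begin
  + (p ^ b)                                 ≡⟨ pow-split p a<b ⟩
  + (p ^ suc a) * + (p ^ (b ∸ suc a))       ≡⟨ ℤP.*-comm (+ (p ^ suc a)) _ ⟩
  + (p ^ (b ∸ suc a)) * + (p ℕ.* p ^ a)     ≡⟨ cong (+ (p ^ (b ∸ suc a)) *_) (ℤP.pos-* p (p ^ a)) ⟩
  + (p ^ (b ∸ suc a)) * (+ p * + (p ^ a))   ≡⟨ cong (+ (p ^ (b ∸ suc a)) *_) (ℤP.*-comm (+ p) (+ (p ^ a))) ⟩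
  + (p ^ (b ∸ suc a)) * (+ (p ^ a) * + p)   ∎)

data Edge {m : ℕ} : Fin (suc m) → Set where
  inner   : (i : Fin m) → Edge (inject₁ i)
  closing : Edge (fromℕ m)

edgeView : ∀ {m} (e : Fin (suc m)) → Edge e
edgeView {zero} zero = closing
edgeView {suc m} zero = inner zero
edgeView {suc m} (suc e) with edgeView e
... | inner i = inner (suc i)
... | closing = closing

cycTgt-inner : ∀ {m} (i : Fin m) → cycTgt (inject₁ i) ≡ suc i
cycTgt-inner {m} i = FinP.toℕ-injective (begin
  toℕ (cycTgt (inject₁ i))       ≡⟨ FinP.toℕ-fromℕ< _ ⟩
  suc (toℕ (inject₁ i)) % suc m  ≡⟨ cong (λ n → suc n % suc m) (FinP.toℕ-inject₁ i) ⟩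
  suc (toℕ i) % suc m            ≡⟨ m<n⇒m%n≡m (s≤s (FinP.toℕ<n i)) ⟩
  suc (toℕ i)                    ∎)

cycTgt-closing : ∀ m → cycTgt (fromℕ m) ≡ zero
cycTgt-closing m = FinP.toℕ-injective (begin
  toℕ (cycTgt (fromℕ m))         ≡⟨ FinP.toℕ-fromℕ< _ ⟩
  suc (toℕ (fromℕ m)) % suc m    ≡⟨ cong (λ n → suc n % suc m) (FinP.toℕ-fromℕ m) ⟩
  suc m % suc m                  ≡⟨ n%n≡0 (suc m) ⟩
  0                              ∎)

if-true : ∀ {A : Set} {b} {x y : A} → T b → (if b then x else y) ≡ x
if-true {b = true} _ = refl

if-false : ∀ {A : Set} {b} {x y : A} → ¬ T b → (if b then x else y) ≡ y
if-false {b = false} _ = refl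
if-false {b = true} ¬t = ⊥-elim (¬t _)

module Generators (p : ℕ) {m : ℕ} (j : Fin (suc m) → ℕ) where

  G : Fin (suc m) → Labeling (suc m)
  G = splineGens p j

  ℓ : Fin m → ℤ
  ℓ i = + (p ^ j (inject₁ i))

  bVec-before : ∀ i v → toℕ v ≤ toℕ i → bVec p j i v ≡ + 0
  bVec-before i v v≤i = if-true (ℕP.≤⇒≤ᵇ v≤i)

  bVec-after : ∀ i v → toℕ i < toℕ v → bVec p j i v ≡ ℓ i
  bVec-after i v i<v = if-false (λ v≤i → ℕP.<⇒≱ i<v (ℕP.≤ᵇ⇒≤ (toℕ v) (toℕ i) v≤i))

  bVec-last : ∀ i → bVec p j i (fromℕ m) ≡ ℓ i
  bVec-last i = bVec-after i (fromℕ m) (subst (toℕ i <_) (sym (FinP.toℕ-fromℕ m)) (FinP.toℕ<n i))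

  gen-jump : ∀ i → G (suc i) (suc i) - G (suc i) (inject₁ i) ≡ ℓ i
  gen-jump i = begin
    bVec p j i (suc i) - bVec p j i (inject₁ i)
      ≡⟨ cong₂ _-_ (bVec-after i (suc i) (ℕP.n<1+n (toℕ i)))
                   (bVec-before i (inject₁ i) (ℕP.≤-reflexive (FinP.toℕ-inject₁ i))) ⟩
    ℓ i - + 0 ≡⟨ ℤP.+-identityʳ (ℓ i) ⟩
    ℓ i       ∎

  gen-flat : ∀ s i → s ≢ suc i → G s (suc i) ≡ G s (inject₁ i)
  gen-flat zero i _ = refl
  gen-flat (suc i′) i i′≢i with ℕP.<-cmp (toℕ i′) (toℕ i)
  ... | tri< i′<i _ _ = trans (bVec-after i′ (suc i) (ℕP.m<n⇒m<1+n i′<i))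
    (sym (bVec-after i′ (inject₁ i) (subst (toℕ i′ <_) (sym (FinP.toℕ-inject₁ i)) i′<i)))
  ... | tri≈ _ i′≡i _ = ⊥-elim (i′≢i (cong suc (FinP.toℕ-injective i′≡i)))
  ... | tri> _ _ i<i′ = trans (bVec-before i′ (suc i) i<i′)
    (sym (bVec-before i′ (inject₁ i) (ℕP.≤-trans (ℕP.≤-reflexive (FinP.toℕ-inject₁ i)) (ℕP.<⇒≤ i<i′))))

  genComb-first : ∀ d → linComb d G zero ≡ d zero
  genComb-first d = trans (sumFin-single (λ s → d s * G s zero) zero vanish) (ℤP.*-identityʳ (d zero))
    where
    vanish : ∀ s → s ≢ zero → d s * G s zero ≡ + 0
    vanish zero s≢0 = ⊥-elim (s≢0 refl)
    vanish (suc s) _ = ℤP.*-zeroʳ (d (suc s))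

  genComb-step : ∀ d i → linComb d G (suc i) - linComb d G (inject₁ i) ≡ d (suc i) * ℓ i
  genComb-step d i = begin
    linComb d G (suc i) - linComb d G (inject₁ i)
      ≡⟨ linComb-diff d G (suc i) (inject₁ i) ⟩
    sumFin (λ s → d s * (G s (suc i) - G s (inject₁ i)))
      ≡⟨ sumFin-single (λ s → d s * (G s (suc i) - G s (inject₁ i))) (suc i) vanish ⟩
    d (suc i) * (G (suc i) (suc i) - G (suc i) (inject₁ i))
      ≡⟨ cong (d (suc i) *_) (gen-jump i) ⟩
    d (suc i) * ℓ i ∎
    where
    vanish : ∀ s → s ≢ suc i → d s * (G s (suc i) - G s (inject₁ i)) ≡ + 0
    vanish s s≢i = begin
      d s * (G s (suc i) - G s (inject₁ i))       ≡⟨ cong (λ y → d s * (y - G s (inject₁ i))) (gen-flat s i s≢i) ⟩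
      d s * (G s (inject₁ i) - G s (inject₁ i))   ≡⟨ cong (d s *_) (ℤP.+-inverseʳ (G s (inject₁ i))) ⟩
      d s * + 0                                   ≡⟨ ℤP.*-zeroʳ (d s) ⟩
      + 0                                         ∎

module Splines (p k : ℕ) {m : ℕ} (j : Fin (suc m) → ℕ) where

  open Generators p j

  q : ℕ
  q = p ^ k

  inIdeal : ∀ e x σ → x ≈[ q ] + (p ^ e) * σ → InIdeal p k e x
  inIdeal e x σ h = σ , ∣⇒∣ᵤ (q∣x-y h)

  spline-inner : ∀ f → IsSpline p k j f → ∀ i → ∃ λ σ → f (inject₁ i) - f (suc i) ≈[ q ] ℓ i * σ
  spline-inner f spline i = σ , subst (λ w → f (inject₁ i) - f w ≈[ q ] ℓ i * σ) (cycTgt-inner i)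
                                        (modulo (∣ᵤ⇒∣ (proj₂ (spline (inject₁ i)))))
    where
    σ = proj₁ (spline (inject₁ i))

  linComb-spline : ∀ {r} (c : Fin r → ℤ) (g : Fin r → Labeling (suc m)) →
    (∀ t → IsSpline p k j (g t)) → IsSpline p k j (linComb c g)
  linComb-spline c g splines e = inIdeal (j e) _ (sumFin (λ t → c t * σ t))
    (≈-trans (≈-reflexive (linComb-diff c g e (cycTgt e)))
    (≈-trans (≈-weightedSum c (λ t → g t e - g t (cycTgt e)) (λ t → ℓₑ * σ t) edge)
             (≈-reflexive factor)))
    where
    ℓₑ = + (p ^ j e)
    σ : Fin _ → ℤ
    σ t = proj₁ (splines t e)
    edge : ∀ t → g t e - g t (cycTgt e) ≈[ q ] ℓₑ * σ t
    edge t = modulo (∣ᵤ⇒∣ (proj₂ (splines t e)))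
    rearrange : ∀ c ℓ σ → c * (ℓ * σ) ≡ ℓ * (c * σ)
    rearrange = solve-∀
    factor : sumFin (λ t → c t * (ℓₑ * σ t)) ≡ ℓₑ * sumFin (λ t → c t * σ t)
    factor = trans (sumFin-cong (λ t → rearrange (c t) ℓₑ (σ t))) (sumFin-*ˡ ℓₑ (λ t → c t * σ t))

  -- Every generator is a spline.  Only b⁽ⁱ⁾ across edge i and across the closing edge
  -- needs care: there it jumps by ℓᵢ, which lies in ⟨ℓₙ⟩ because ℓₙ has minimal exponent.
  gens-spline : (∀ e → j (fromℕ m) ≤ j e) → ∀ s → IsSpline p k j (G s)
  gens-spline minimal zero e = inIdeal (j e) _ (+ 0) (≈-reflexive (sym (ℤP.*-zeroʳ (+ (p ^ j e)))))
  gens-spline minimal (suc i) e with edgeView e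
  ... | closing = inIdeal (j (fromℕ m)) _ (+ (p ^ (j (inject₁ i) ∸ j (fromℕ m)))) (≈-reflexive (begin
        bVec p j i (fromℕ m) - bVec p j i (cycTgt (fromℕ m))
          ≡⟨ cong (λ w → bVec p j i (fromℕ m) - bVec p j i w) (cycTgt-closing m) ⟩
        bVec p j i (fromℕ m) - + 0
          ≡⟨ ℤP.+-identityʳ _ ⟩
        bVec p j i (fromℕ m)
          ≡⟨ bVec-last i ⟩
        ℓ i
          ≡⟨ pow-split p (minimal (inject₁ i)) ⟩
        + (p ^ j (fromℕ m)) * + (p ^ (j (inject₁ i) ∸ j (fromℕ m))) ∎))
  ... | inner i′ with i ≟ i′
  ...   | yes refl = inIdeal (j (inject₁ i)) _ (- + 1) (≈-reflexive (begin
          G (suc i) (inject₁ i) - G (suc i) (cycTgt (inject₁ i))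
            ≡⟨ cong (λ w → G (suc i) (inject₁ i) - G (suc i) w) (cycTgt-inner i) ⟩
          G (suc i) (inject₁ i) - G (suc i) (suc i)
            ≡⟨ reverse (G (suc i) (inject₁ i)) (G (suc i) (suc i)) ⟩
          - (G (suc i) (suc i) - G (suc i) (inject₁ i))
            ≡⟨ cong -_ (gen-jump i) ⟩
          - ℓ i
            ≡⟨ negate (ℓ i) ⟩
          ℓ i * - + 1 ∎))
    where
    reverse : ∀ a b → a - b ≡ - (b - a)
    reverse = solve-∀
    negate : ∀ a → - a ≡ a * - + 1
    negate = solve-∀
  ...   | no i≢i′ = inIdeal (j (inject₁ i′)) _ (+ 0) (≈-reflexive (begin
          G (suc i) (inject₁ i′) - G (suc i) (cycTgt (inject₁ i′))
            ≡⟨ cong (λ w → G (suc i) (inject₁ i′) - G (suc i) w) (cycTgt-inner i′) ⟩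
          G (suc i) (inject₁ i′) - G (suc i) (suc i′)
            ≡⟨ cong (_-_ (G (suc i) (inject₁ i′))) (gen-flat (suc i) i′ (i≢i′ ∘ FinP.suc-injective)) ⟩
          G (suc i) (inject₁ i′) - G (suc i) (inject₁ i′)
            ≡⟨ ℤP.+-inverseʳ (G (suc i) (inject₁ i′)) ⟩
          + 0
            ≡⟨ sym (ℤP.*-zeroʳ (ℓ i′)) ⟩
          ℓ i′ * + 0 ∎))

  -- The generators span: f agrees with f(v₁)·1 − Σ σᵢ b⁽ⁱ⁾, where f(vᵢ) − f(vᵢ₊₁) ≡ ℓᵢσᵢ,
  -- since both have the same value at v₁ and the same increments along the path.
  gens-span : ∀ f → IsSpline p k j f → ∃ λ c → ∀ v → f v ≈[ q ] linComb c G v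
  gens-span f spline = c , ≈-byIncrements f (linComb c G) start step
    where
    σ : Fin m → ℤ
    σ i = proj₁ (spline-inner f spline i)
    c : Fin (suc m) → ℤ
    c zero = f zero
    c (suc i) = - σ i
    start : f zero ≈[ q ] linComb c G zero
    start = ≈-reflexive (sym (genComb-first c))
    step : ∀ i → f (suc i) - f (inject₁ i) ≈[ q ] linComb c G (suc i) - linComb c G (inject₁ i)
    step i = ≈-trans (≈-swapDiff (f (inject₁ i)) (f (suc i)) (ℓ i * σ i) (proj₂ (spline-inner f spline i)))
                     (≈-reflexive (trans (negate (ℓ i) (σ i)) (sym (genComb-step c i))))
      where
      negate : ∀ ℓ σ → - (ℓ * σ) ≡ - σ * ℓ
      negate = solve-∀

module Minimality (p : ℕ) (p-prime : Prime p) (k′ : ℕ) {m : ℕ} (j : Fin (suc m) → ℕ)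
                  (j≤k′ : ∀ e → j e ≤ k′) (minimal : ∀ e → j (fromℕ m) ≤ j e) where

  open Generators p j
  open Splines p (suc k′) j
  open IndependenceModPrime p p-prime

  instance
    p≢0 : ℕ.NonZero p
    p≢0 = prime⇒nonZero p-prime

  p∣q : + p ∣ + q
  p∣q = subst (_∣ + q) (ℤP.*-identityˡ (+ p)) (pow-step-dvd p {0} {suc k′} (s≤s z≤n))

  coefficients-divisible : ∀ d H → IsSpline p (suc k′) j H →
    (∀ v → linComb d G v ≈[ q ] + p * H v) → ∀ s → + p ∣ d s
  coefficients-divisible d H spline agree zero =
    ∣m+n∣n⇒∣m (∣-trans p∣q (q∣x-y first)) (∣m⇒∣-m (∣m⇒∣m*n (H zero) ∣-refl))
    where
    first : d zero ≈[ q ] + p * H zero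
    first = subst (_≈[ q ] + p * H zero) (genComb-first d) (agree zero)
  coefficients-divisible d H spline agree (suc i) =
    ∣m+n∣n⇒∣m p∣d+pσ (∣m⇒∣m*n σ ∣-refl)
    where
    F = linComb d G
    σ = proj₁ (spline-inner H spline i)
    -- Across edge i, F increases by dᵢ₊₁ℓᵢ while p·H decreases by pℓᵢσ (mod q).
    combine : ∀ Fₛ Fᵢ Hₛ Hᵢ ℓ p σ →
      ((Fₛ - p * Hₛ) - (Fᵢ - p * Hᵢ)) - p * ((Hᵢ - Hₛ) - ℓ * σ) ≡ (Fₛ - Fᵢ) + ℓ * (p * σ)
    combine = solve-∀
    edge : + q ∣ ℓ i * (d (suc i) + + p * σ)
    edge = subst (+ q ∣_)
      (begin
        ((F (suc i) - + p * H (suc i)) - (F (inject₁ i) - + p * H (inject₁ i)))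
          - + p * ((H (inject₁ i) - H (suc i)) - ℓ i * σ)
          ≡⟨ combine (F (suc i)) (F (inject₁ i)) (H (suc i)) (H (inject₁ i)) (ℓ i) (+ p) σ ⟩
        (F (suc i) - F (inject₁ i)) + ℓ i * (+ p * σ)
          ≡⟨ cong (_+ ℓ i * (+ p * σ)) (genComb-step d i) ⟩
        d (suc i) * ℓ i + ℓ i * (+ p * σ)
          ≡⟨ cong (_+ ℓ i * (+ p * σ)) (ℤP.*-comm (d (suc i)) (ℓ i)) ⟩
        ℓ i * d (suc i) + ℓ i * (+ p * σ)
          ≡⟨ sym (ℤP.*-distribˡ-+ (ℓ i) (d (suc i)) (+ p * σ)) ⟩
        ℓ i * (d (suc i) + + p * σ) ∎)
      (∣m∣n⇒∣m-n (∣m∣n⇒∣m-n (q∣x-y (agree (suc i))) (q∣x-y (agree (inject₁ i))))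
                 (∣n⇒∣m*n (+ p) (q∣x-y (proj₂ (spline-inner H spline i)))))
    -- ℓᵢ·p divides q, so ℓᵢ can be cancelled.
    p∣d+pσ : + p ∣ d (suc i) + + p * σ
    p∣d+pσ = *-cancelˡ-∣ (ℓ i) {{ℕP.m^n≢0 p (j (inject₁ i))}}
               (∣-trans (pow-step-dvd p (s≤s (j≤k′ (inject₁ i)))) edge)

  generator-rows-independent : ∀ {r} (g : Fin r → Labeling (suc m)) → (∀ t → IsSpline p (suc k′) j (g t)) →
    (C : Fin (suc m) → Fin r → ℤ) → (∀ s v → G s v ≈[ q ] linComb (C s) g v) → Independent C
  generator-rows-independent g splines C expansion d relation =
    coefficients-divisible d (linComb e g) (linComb-spline e g splines) agree
    where
    e : Fin _ → ℤ
    e t = _∣_.quotient (relation t)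
    reassociate : ∀ e p g → e * p * g ≡ p * (e * g)
    reassociate = solve-∀
    agree : ∀ v → linComb d G v ≈[ q ] + p * linComb e g v
    agree v = ≈-trans (≈-weightedSum d (λ s → G s v) (λ s → linComb (C s) g v) (λ s → expansion s v))
      (≈-reflexive (begin
        sumFin (λ s → d s * linComb (C s) g v)
          ≡⟨ linComb-compose d C g v ⟩
        sumFin (λ t → sumFin (λ s → d s * C s t) * g t v)
          ≡⟨ sumFin-cong (λ t → cong (_* g t v) (_∣_.equality (relation t))) ⟩
        sumFin (λ t → e t * + p * g t v)
          ≡⟨ sumFin-cong (λ t → reassociate (e t) (+ p) (g t v)) ⟩
        sumFin (λ t → + p * (e t * g t v))
          ≡⟨ sumFin-*ˡ (+ p) (λ t → e t * g t v) ⟩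
        + p * linComb e g v ∎))

  minimality : ∀ r (g : Fin r → Labeling (suc m)) → Generates p (suc k′) j g → suc m ≤ r
  minimality r g (splines , span) = independent⇒≤ C (generator-rows-independent g splines C expansion)
    where
    C : Fin (suc m) → Fin r → ℤ
    C s = proj₁ (span (G s) (gens-spline minimal s))
    expansion : ∀ s v → G s v ≈[ q ] linComb (C s) g v
    expansion s v = modulo (∣ᵤ⇒∣ (proj₂ (span (G s) (gens-spline minimal s)) v))

-- Writing k = k′ + 1, generation comes from Splines and minimality from Minimality.
mainTheorem16 : (p k m : ℕ) → Prime p → 1 ≤ k → 2 ≤ m →
    (j : Fin (suc m) → ℕ) →
    (∀ i → 1 ≤ j i) → (∀ i → j i ≤ k ∸ 1) →
    (∀ i → j (fromℕ m) ≤ j i) →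
    MinimumGenerating p k j (splineGens p j)
mainTheorem16 p (suc k′) m p-prime _ _ j _ j≤k′ minimal =
  (gens-spline minimal , spanning) , Minimality.minimality p p-prime k′ j j≤k′ minimal
  where
  open Splines p (suc k′) j
  spanning : ∀ f → IsSpline p (suc k′) j f → ∃ λ c → ∀ v → f v ≡[ q ] linComb c (splineGens p j) v
  spanning f spline = proj₁ (gens-span f spline) , λ v → ∣⇒∣ᵤ (q∣x-y (proj₂ (gens-span f spline) v))
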